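{- Let $M$ be a matroid on ground set $S$, let $g\ge 3$ be an integer, and let $\mathcal{C}$ be a family of circuits of $M$ such that for every $1\le i\le g-1$ and every $X\subseteq S$ with $|X|=i$ we have $|\{C\in\mathcal{C}:\ |X\cap C|\ge 2\}|\le i-1$. Then in every rainbow circuit-free coloring of $M$ in which each color is used at most $g-1$ times, the number $q$ of distinct colors satisfies $|\mathcal{C}|/(g-2)\le q\le |S|-|\mathcal{C}|$.
   Context: A coloring of $S$ is a partition into nonempty color classes; it is rainbow circuit-free if every circuit of $M$ contains two elements of the same color. -}

module Defs where

open import Data.Nat using (ℕ; suc; _≤_; _∸_; _≤?_)
open import Data.Fin using (Fin) renaming (_≟_ to _≟ᶠ_)
open import Data.Fin.Subset using (Subset; ⁅_⁆; _∈_; _∉_; _⊆_; _∩_; _∪_; _-_; ∣_∣; ⊥)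
open import Data.Vec using (tabulate)
open import Data.List using (List; length; filter)
open import Data.Product using (Σ; ∃; ∃-syntax; _×_; _,_)
open import Function using (Surjective)
open import Relation.Nullary using (¬_; Dec)
open import Relation.Nullary.Decidable using (⌊_⌋)
open import Relation.Binary.PropositionalEquality using (_≡_; _≢_)

record Matroid (n : ℕ) : Set₁ where
  field
    Indep       : Subset n → Set
    indep-∅     : Indep ⊥
    indep-⊆     : ∀ {A B} → A ⊆ B → Indep B → Indep A
    indep-exch  : ∀ {A B} → Indep A → Indep B → ∣ A ∣ Data.Nat.< ∣ B ∣ →
                  ∃[ x ] (x ∈ B × x ∉ A × Indep (A ∪ ⁅ x ⁆))

open Matroid public

IsCircuit : ∀ {n} → Matroid n → Subset n → Set
IsCircuit M C = ¬ Indep M C × (∀ x → x ∈ C → Indep M (C - x))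

count≥2 : ∀ {n} → Subset n → List (Subset n) → ℕ
count≥2 X 𝒞 = length (filter (λ C → 2 ≤? ∣ X ∩ C ∣) 𝒞)

GoodFamily : ∀ {n : ℕ} → ℕ → List (Subset n) → Set
GoodFamily {n} g 𝒞 = ∀ (i : ℕ) → 1 ≤ i → i ≤ g ∸ 1 →
  ∀ (X : Subset n) → ∣ X ∣ ≡ i → count≥2 X 𝒞 ≤ i ∸ 1

-- A coloring with q colors: a map S → Fin q that is surjective, i.e. the
-- color classes (fibres) form a partition of S into nonempty classes.
IsColoring : ∀ {n q} → (Fin n → Fin q) → Set
IsColoring c = Surjective _≡_ _≡_ c

colorClass : ∀ {n q} → (Fin n → Fin q) → Fin q → Subset n
colorClass c k = tabulate (λ x → ⌊ c x ≟ᶠ k ⌋)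

RainbowCircuitFree : ∀ {n q} → Matroid n → (Fin n → Fin q) → Set
RainbowCircuitFree M c = ∀ C → IsCircuit M C →
  ∃[ x ] ∃[ y ] (x ∈ C × y ∈ C × x ≢ y × c x ≡ c y)

-- Every circuit of 𝒞 contains two elements of a common color class K, so
-- |𝒞| ≤ Σ_K #{C ∈ 𝒞 : |K ∩ C| ≥ 2}. A class has between 1 and g − 1 elements,
-- so the hypothesis on 𝒞 bounds its term by |K| − 1 ≤ g − 2. Summing over the
-- q classes gives |𝒞| ≤ Σ_K (|K| − 1) = |S| − q and |𝒞| ≤ (g − 2) q.
module Submission where

open import Defs
open import Data.Bool using (Bool; true; false)
open import Data.Nat using (ℕ; zero; suc; _≤_; _<_; _∸_; _*_; _+_; z≤n; s≤s; _≤?_)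
open import Data.Nat.Properties
  using (+-0-commutativeMonoid; *-zeroʳ; +-mono-≤; +-mono-<-≤; +-mono-≤-<; +-monoʳ-≤; *-identityʳ; *-comm; ≤-refl; ≤-reflexive; ≤-trans; n≤1+n; m+[n∸m]≡n; ∸-monoˡ-≤; ∸-+-assoc; module ≤-Reasoning)
open import Data.Fin using (Fin; zero; suc; _≟_)
open import Data.Fin.Subset using (Subset; ∣_∣; _∈_; _∩_)
open import Data.Fin.Subset.Properties using (x∈p∩q⁺; x∈p⇒∣p-x∣<∣p∣; x∈p∧x≢y⇒x∈p-y)
open import Data.Vec using (_∷_; tabulate)
open import Data.Vec.Properties using (lookup∘tabulate; lookup⇒[]=)
open import Data.List using (List; []; _∷_; length; filter)
open import Data.List.Properties using (filter-accept)
open import Data.List.Relation.Unary.All using (All; []; _∷_)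
import Data.List.Relation.Unary.All as All
open import Data.List.Relation.Unary.Unique.Propositional using (Unique)
open import Data.Product using (_×_; _,_; ∃-syntax)
open import Function using (_∘_)
open import Relation.Nullary using (yes; no)
open import Relation.Nullary.Decidable using (⌊_⌋; dec-true; isYes≗does; ⌊⌋-map′)
open import Relation.Unary using (Pred; Decidable)
open import Relation.Binary.PropositionalEquality using (_≡_; _≢_; refl; sym; trans; cong; module ≡-Reasoning)

open import Algebra.Properties.CommutativeMonoid.Sum +-0-commutativeMonoid
  using (sum-syntax; sum-cong-≗; ∑-comm; ∑-distrib-+)

∑-mono-≤ : ∀ {q} {f h : Fin q → ℕ} → (∀ k → f k ≤ h k) → ∑[ k < q ] f k ≤ ∑[ k < q ] h k
∑-mono-≤ {zero}  f≤h = z≤n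
∑-mono-≤ {suc q} f≤h = +-mono-≤ (f≤h zero) (∑-mono-≤ (f≤h ∘ suc))

∑-mono-< : ∀ {q} {f h : Fin q → ℕ} → (∀ k → f k ≤ h k) → (j : Fin q) → f j < h j →
           ∑[ k < q ] f k < ∑[ k < q ] h k
∑-mono-< f≤h zero    fj<hj = +-mono-<-≤ fj<hj (∑-mono-≤ (f≤h ∘ suc))
∑-mono-< f≤h (suc j) fj<hj = +-mono-≤-< (f≤h zero) (∑-mono-< (f≤h ∘ suc) j fj<hj)

∑-const : ∀ q a → ∑[ k < q ] a ≡ q * a
∑-const zero    a = refl
∑-const (suc q) a = cong (a +_) (∑-const q a)

q+∑[f∸1]≡∑f : ∀ {q} (f : Fin q → ℕ) → (∀ k → 1 ≤ f k) → q + ∑[ k < q ] (f k ∸ 1) ≡ ∑[ k < q ] f k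
q+∑[f∸1]≡∑f {q} f 1≤f = begin
  q + ∑[ k < q ] (f k ∸ 1)              ≡⟨ cong (_+ ∑[ k < q ] (f k ∸ 1)) ∑1≡q ⟨
  ∑[ k < q ] 1 + ∑[ k < q ] (f k ∸ 1)   ≡⟨ sym (∑-distrib-+ (λ _ → 1) (λ k → f k ∸ 1)) ⟩
  ∑[ k < q ] (1 + (f k ∸ 1))            ≡⟨ sum-cong-≗ (λ k → m+[n∸m]≡n (1≤f k)) ⟩
  ∑[ k < q ] f k                        ∎
  where
  open ≡-Reasoning
  ∑1≡q : ∑[ k < q ] 1 ≡ q
  ∑1≡q = trans (∑-const q 1) (*-identityʳ q)

length≤∑length-filter : ∀ {q a p} {A : Set a} {P : Fin q → Pred A p} (P? : ∀ k → Decidable (P k)) →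
  (xs : List A) → All (λ x → ∃[ k ] P k x) xs → length xs ≤ ∑[ k < q ] length (filter (P? k) xs)
length≤∑length-filter P? []       []               = z≤n
length≤∑length-filter P? (x ∷ xs) ((k , Pkx) ∷ Pxs) =
  ≤-trans (s≤s (length≤∑length-filter P? xs Pxs))
          (∑-mono-< filter-∷-grows k (≤-reflexive (cong length (sym (filter-accept (P? k) Pkx)))))
  where
  filter-∷-grows : ∀ j → length (filter (P? j) xs) ≤ length (filter (P? j) (x ∷ xs))
  filter-∷-grows j with P? j x
  ... | yes _ = n≤1+n _
  ... | no _  = ≤-refl

boolToℕ : Bool → ℕ
boolToℕ true  = 1
boolToℕ false = 0

∣b∷p∣≡boolToℕb+∣p∣ : ∀ {n} (b : Bool) (p : Subset n) → ∣ b ∷ p ∣ ≡ boolToℕ b + ∣ p ∣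
∣b∷p∣≡boolToℕb+∣p∣ true  p = refl
∣b∷p∣≡boolToℕb+∣p∣ false p = refl

∣tabulate∣≡∑ : ∀ {n} (f : Fin n → Bool) → ∣ tabulate f ∣ ≡ ∑[ x < n ] boolToℕ (f x)
∣tabulate∣≡∑ {zero}  f = refl
∣tabulate∣≡∑ {suc n} f = trans (∣b∷p∣≡boolToℕb+∣p∣ (f zero) (tabulate (f ∘ suc)))
                              (cong (boolToℕ (f zero) +_) (∣tabulate∣≡∑ (f ∘ suc)))

∑-δ : ∀ {q} (j : Fin q) → ∑[ k < q ] boolToℕ ⌊ j ≟ k ⌋ ≡ 1
∑-δ {suc q} zero    = cong suc (trans (∑-const q 0) (*-zeroʳ q))
∑-δ {suc q} (suc j) = trans (sum-cong-≗ (λ k → cong boolToℕ (⌊⌋-map′ _ _ (j ≟ k)))) (∑-δ j)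

∑∣colorClass∣≡n : ∀ {n q} (c : Fin n → Fin q) → ∑[ k < q ] ∣ colorClass c k ∣ ≡ n
∑∣colorClass∣≡n {n} {q} c = begin
  ∑[ k < q ] ∣ colorClass c k ∣                   ≡⟨ sum-cong-≗ (λ k → ∣tabulate∣≡∑ (λ x → ⌊ c x ≟ k ⌋)) ⟩
  ∑[ k < q ] ∑[ x < n ] boolToℕ ⌊ c x ≟ k ⌋       ≡⟨ ∑-comm (λ k x → boolToℕ ⌊ c x ≟ k ⌋) ⟩
  ∑[ x < n ] ∑[ k < q ] boolToℕ ⌊ c x ≟ k ⌋       ≡⟨ sum-cong-≗ (λ x → ∑-δ (c x)) ⟩
  ∑[ x < n ] 1                                    ≡⟨ trans (∑-const n 1) (*-identityʳ n) ⟩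
  n                                               ∎
  where open ≡-Reasoning

x∈colorClass : ∀ {n q} (c : Fin n → Fin q) {x k} → c x ≡ k → x ∈ colorClass c k
x∈colorClass c {x} {k} cx≡k =
  lookup⇒[]= x _ (trans (lookup∘tabulate _ x) (trans (isYes≗does (c x ≟ k)) (dec-true (c x ≟ k) cx≡k)))

x∈p⇒1≤∣p∣ : ∀ {n} {p : Subset n} {x} → x ∈ p → 1 ≤ ∣ p ∣
x∈p⇒1≤∣p∣ x∈p = ≤-trans (s≤s z≤n) (x∈p⇒∣p-x∣<∣p∣ x∈p)

x∈p∧y∈p∧x≢y⇒2≤∣p∣ : ∀ {n} {p : Subset n} {x y} → x ∈ p → y ∈ p → x ≢ y → 2 ≤ ∣ p ∣
x∈p∧y∈p∧x≢y⇒2≤∣p∣ x∈p y∈p x≢y =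
  ≤-trans (s≤s (x∈p⇒1≤∣p∣ (x∈p∧x≢y⇒x∈p-y y∈p (x≢y ∘ sym)))) (x∈p⇒∣p-x∣<∣p∣ x∈p)

circuit-meets-colorClass-twice : ∀ {n q} {M : Matroid n} {c : Fin n → Fin q} → RainbowCircuitFree M c →
  ∀ {C} → IsCircuit M C → ∃[ k ] 2 ≤ ∣ colorClass c k ∩ C ∣
circuit-meets-colorClass-twice {c = c} rcf isC with rcf _ isC
... | x , y , x∈C , y∈C , x≢y , cx≡cy =
  c x , x∈p∧y∈p∧x≢y⇒2≤∣p∣ (x∈p∩q⁺ (x∈colorClass c refl , x∈C))
                           (x∈p∩q⁺ (x∈colorClass c (sym cx≡cy) , y∈C)) x≢y

length≤∑count≥2-colorClass : ∀ {n q} (M : Matroid n) (c : Fin n → Fin q) → RainbowCircuitFree M c →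
  ∀ {𝒞} → All (IsCircuit M) 𝒞 → length 𝒞 ≤ ∑[ k < q ] count≥2 (colorClass c k) 𝒞
length≤∑count≥2-colorClass {n} {q} M c rcf circuits =
  length≤∑length-filter {P = MeetsTwice} (λ k C → 2 ≤? ∣ colorClass c k ∩ C ∣) _
    (All.map (circuit-meets-colorClass-twice {M = M} rcf) circuits)
  where
  MeetsTwice : Fin q → Subset n → Set
  MeetsTwice k C = 2 ≤ ∣ colorClass c k ∩ C ∣

theorem7 : ∀ {n : ℕ} (M : Matroid n) (g : ℕ) → 3 ≤ g →
    (𝒞 : List (Subset n)) → Unique 𝒞 → All (IsCircuit M) 𝒞 →
    GoodFamily g 𝒞 →
    ∀ (q : ℕ) (c : Fin n → Fin q) → IsColoring c →
    RainbowCircuitFree M c →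
    (∀ (k : Fin q) → ∣ colorClass c k ∣ ≤ g ∸ 1) →
    (length 𝒞 ≤ (g ∸ 2) * q) × (q + length 𝒞 ≤ n)
theorem7 {n} M g _ 𝒞 _ circuits good q c surjective rcf ∣K∣≤g∸1 = ∣𝒞∣≤[g∸2]q , q+∣𝒞∣≤n
  where
  open ≤-Reasoning

  K : Fin q → Subset n
  K = colorClass c

  1≤∣K∣ : ∀ k → 1 ≤ ∣ K k ∣
  1≤∣K∣ k with surjective k
  ... | x , cx≡k = x∈p⇒1≤∣p∣ (x∈colorClass c (cx≡k refl))

  ∣𝒞∣≤∑[∣K∣∸1] : length 𝒞 ≤ ∑[ k < q ] (∣ K k ∣ ∸ 1)
  ∣𝒞∣≤∑[∣K∣∸1] = ≤-trans (length≤∑count≥2-colorClass M c rcf circuits)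
                         (∑-mono-≤ (λ k → good ∣ K k ∣ (1≤∣K∣ k) (∣K∣≤g∸1 k) (K k) refl))

  ∣𝒞∣≤[g∸2]q : length 𝒞 ≤ (g ∸ 2) * q
  ∣𝒞∣≤[g∸2]q = begin
    length 𝒞                    ≤⟨ ∣𝒞∣≤∑[∣K∣∸1] ⟩
    ∑[ k < q ] (∣ K k ∣ ∸ 1)    ≤⟨ ∑-mono-≤ (λ k → ∸-monoˡ-≤ 1 (∣K∣≤g∸1 k)) ⟩
    ∑[ k < q ] (g ∸ 1 ∸ 1)      ≡⟨ ∑-const q (g ∸ 1 ∸ 1) ⟩
    q * (g ∸ 1 ∸ 1)             ≡⟨ cong (q *_) (∸-+-assoc g 1 1) ⟩
    q * (g ∸ 2)                 ≡⟨ *-comm q (g ∸ 2) ⟩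
    (g ∸ 2) * q                 ∎

  q+∣𝒞∣≤n : q + length 𝒞 ≤ n
  q+∣𝒞∣≤n = begin
    q + length 𝒞                  ≤⟨ +-monoʳ-≤ q ∣𝒞∣≤∑[∣K∣∸1] ⟩
    q + ∑[ k < q ] (∣ K k ∣ ∸ 1)  ≡⟨ q+∑[f∸1]≡∑f (∣_∣ ∘ K) 1≤∣K∣ ⟩
    ∑[ k < q ] ∣ K k ∣            ≡⟨ ∑∣colorClass∣≡n c ⟩
    n                             ∎
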